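{- Let $b,s,k$ be positive integers, let $R=4bs-1$, and set \[ D:=\left(bR^{2k+1}+s\right)^2-R^{2k+1}. \] Define $f_1,\dots,f_{3k}$ by $f_{3j+1}=1$, $f_{3j+2}=2bR^j-1$, $f_{3j+3}=2bR^{2k-j}-1$ for $0\le j\le k-1$ (so the sequence is $1,2b-1,2bR^{2k}-1,\ 1,2bR-1,2bR^{2k-1}-1,\dots,1,2bR^{k-1}-1,2bR^{k+1}-1$). Then $l(D)=6k+5$ and \[ \sqrt D=[bR^{2k+1}+s-1;\overline{f_1,\dots,f_{3k},\,1,\,2bR^k-1,\,2bR^k-1,\,1,\,f_{3k},\dots,f_1,\,2(bR^{2k+1}+s-1)}]. \]
   Context: For a positive non-square integer $D$, $l(D)$ denotes the length of the fundamental (shortest) period of the regular continued fraction expansion of $\sqrt D$. $[a_0;\overline{b_1,\dots,b_m}]$ denotes the regular continued fraction whose partial quotients after $a_0$ are the block $b_1,\dots,b_m$ repeated infinitely often. -}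

module Defs where

open import Data.Nat using (ℕ; zero; suc; _+_; _*_; _∸_; _^_; _≤_; _<_; _≤ᵇ_)
open import Data.Nat.DivMod using (_/_; _%_)
open import Data.Bool using (if_then_else_)
open import Data.List using (List; []; _∷_; _++_; reverse; concatMap; upTo)
open import Data.Product using (_×_; _,_; proj₁; proj₂)
open import Relation.Binary.PropositionalEquality using (_≡_)

fsqrt : ℕ → ℕ
fsqrt zero = zero
fsqrt (suc n) with fsqrt n
... | r = if (suc r * suc r) ≤ᵇ suc n then suc r else r

-- division, total (returns 0 on divisor 0; never used with divisor 0 for non-square D)
div : ℕ → ℕ → ℕ
div m zero = zero
div m (suc q) = m / suc q

-- Standard algorithm for the regular continued fraction of √D:
-- the n-th complete quotient is (P n + √D) / Q n, with
--   P 0 = 0, Q 0 = 1,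
--   a n = ⌊(P n + √D) / Q n⌋ = ⌊(P n + ⌊√D⌋) / Q n⌋,
--   P (n+1) = a n * Q n - P n,  Q (n+1) = (D - P (n+1)^2) / Q n.
PQ : ℕ → ℕ → ℕ × ℕ
PQ D zero = 0 , 1
PQ D (suc n) with PQ D n
... | (P , Q) =
  let a  = div (fsqrt D + P) Q
      P' = a * Q ∸ P
  in P' , div (D ∸ P' * P') Q

-- n-th partial quotient of the regular continued fraction of √D (cf D 0 = ⌊√D⌋)
cf : ℕ → ℕ → ℕ
cf D n = div (fsqrt D + proj₁ (PQ D n)) (proj₂ (PQ D n))

IsPeriod : ℕ → ℕ → Set
IsPeriod D m = ∀ n → 1 ≤ n → cf D (n + m) ≡ cf D n

PeriodLength : ℕ → ℕ → Set
PeriodLength D m = (0 < m) × IsPeriod D m × (∀ m' → 0 < m' → IsPeriod D m' → m ≤ m')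

at : List ℕ → ℕ → ℕ
at [] n = 0
at (x ∷ xs) zero = x
at (x ∷ xs) (suc n) = at xs n

Rof : ℕ → ℕ → ℕ
Rof b s = 4 * b * s ∸ 1

fseq : ℕ → ℕ → ℕ → List ℕ
fseq b s k = concatMap (λ j → 1 ∷ (2 * b * Rof b s ^ j ∸ 1) ∷ (2 * b * Rof b s ^ (2 * k ∸ j) ∸ 1) ∷ []) (upTo k)

a0of : ℕ → ℕ → ℕ → ℕ
a0of b s k = b * Rof b s ^ (2 * k + 1) + s ∸ 1

Dof : ℕ → ℕ → ℕ → ℕ
Dof b s k = (b * Rof b s ^ (2 * k + 1) + s) ^ 2 ∸ Rof b s ^ (2 * k + 1)

block : ℕ → ℕ → ℕ → List ℕ
block b s k =
  fseq b s k ++ (1 ∷ c ∷ c ∷ 1 ∷ []) ++ reverse (fseq b s k) ++ (2 * a0of b s k ∷ [])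
  where c = 2 * b * Rof b s ^ k ∸ 1

{-# OPTIONS --safe #-}
module Submission where

-- Write N = R^(2k+1) and A = bN + s, so that D = A² − N and ⌊√D⌋ = A − 1.  For such a
-- near-square D, the complete quotient (A − c + √D)/Q has partial quotient a and successor
-- (A − c′ + √D)/Q′ as soon as aQ = 2A − c − c′, QQ′ = 2Ac′ − c′² − N and 1 ≤ c′ ≤ Q
-- (with c, c′ ≤ A).  Writing W z w = (A − z, 2A − z − w), U x = (A − x, x) and
-- V z = (A − 2s, z) for the pairs (P , Q), every factorisation N = xy = zw gives
--   W z w →[1] U w,   U x →[2by − 1] V (Ry),   V z →[2bw − 1] W z w,   U 1 →[2(A − 1)] W 1 N
-- (the middle two need 2s ≤ x and 2s ≤ z); the step out of U x works because
-- 4sA − 4s² − N = RN exactly when R = 4bs − 1.  The expansion starts (0 , 1) →[A − 1] W 1 N.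
-- Taking x, y, z, w among the powers of R, it climbs through W (R^j) (R^(2k+1−j)) for
-- j = 0, …, k, descends through U (R^e) for e = k + 1, …, 0 and is back at W 1 N, having
-- emitted exactly the block of the statement.  The last entry 2(A − 1) of the block exceeds
-- all the others, so no shorter period exists.

open import Defs
open import Data.Nat
  using (ℕ; zero; suc; _+_; _*_; _∸_; _^_; _≤_; _<_; _≤ᵇ_; z≤n; s≤s; pred; NonZero; >-nonZero)
open import Data.Nat.DivMod
  using (_%_; _/_; m≡m%n+[m/n]*n; m%n<n; [m+n]%n≡m%n; +-distrib-/-∣ˡ; m*n/n≡m; m<n⇒m/n≡0)
open import Data.Nat.Divisibility using (divides)
open import Data.Nat.Properties
open import Data.Nat.Tactic.RingSolver using (solve; solve-∀)
open import Data.Bool using (true; false; T)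
open import Data.Unit using (tt)
open import Data.Product using (_×_; _,_; proj₁; proj₂)
open import Data.List using (List; []; _∷_; _++_; _∷ʳ_; reverse; concatMap; upTo; length)
open import Data.List.Properties
  using (upTo-∷ʳ; concatMap-++; ++-identityʳ; ++-assoc; reverse-++; unfold-reverse; length-++; length-reverse)
open import Data.List.Relation.Unary.All as All using (All)
open import Data.List.Relation.Unary.All.Properties using (++⁺; ∷ʳ⁺; concat⁺; map⁺; applyUpTo⁺₁)
open import Function using (id; _∘_)
open import Relation.Binary.PropositionalEquality
  using (_≡_; refl; sym; trans; cong; cong₂; subst; subst₂; module ≡-Reasoning)

pred[n]*m+m≡n*m : ∀ {n} m → 1 ≤ n → pred n * m + m ≡ n * m
pred[n]*m+m≡n*m {suc n} m _ = +-comm (n * m) m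

m+n≤m*n+1 : ∀ {m n} → 1 ≤ m → 1 ≤ n → m + n ≤ m * n + 1
m+n≤m*n+1 {suc m} {suc n} _ _ = subst (suc m + suc n ≤_) (sym expand) (m≤m+n _ (m * n))
  where
  expand : suc m * suc n + 1 ≡ suc m + suc n + m * n
  expand = solve (m ∷ n ∷ [])

sum-of-complements : ∀ {A t} x y u v → x + u ≡ A → y + v ≡ A → t + (u + v) ≡ 2 * A → x + y ≡ t
sum-of-complements {A} {t} x y u v x+u≡A y+v≡A sum = +-cancelʳ-≡ (u + v) (x + y) t (begin
  x + y + (u + v)   ≡⟨ solve (x ∷ y ∷ u ∷ v ∷ []) ⟩
  (x + u) + (y + v) ≡⟨ cong₂ _+_ x+u≡A y+v≡A ⟩
  A + A             ≡⟨ solve (A ∷ []) ⟩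
  2 * A             ≡⟨ sym sum ⟩
  t + (u + v)       ∎)
  where open ≡-Reasoning

complete-square : ∀ {A N D P c X} → P + c ≡ A → D + N ≡ A * A →
                  X + N + c * c ≡ 2 * A * c → X + P * P ≡ D
complete-square {A} {N} {D} {P} {c} {X} P+c≡A D+N≡A² norm = +-cancelʳ-≡ (N + c * c) (X + P * P) D (begin
  X + P * P + (N + c * c)         ≡⟨ solve (X ∷ P ∷ N ∷ c ∷ []) ⟩
  P * P + (X + N + c * c)         ≡⟨ cong (P * P +_) norm ⟩
  P * P + 2 * A * c               ≡⟨ cong (λ a → P * P + 2 * a * c) (sym P+c≡A) ⟩
  P * P + 2 * (P + c) * c         ≡⟨ solve (P ∷ c ∷ []) ⟩
  (P + c) * (P + c) + c * c       ≡⟨ cong (λ a → a * a + c * c) P+c≡A ⟩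
  A * A + c * c                   ≡⟨ cong (_+ c * c) (sym D+N≡A²) ⟩
  D + N + c * c                   ≡⟨ +-assoc D N (c * c) ⟩
  D + (N + c * c)                 ∎)
  where open ≡-Reasoning

div-quotient : ∀ {a m Q} → m < Q → div (a * Q + m) Q ≡ a
div-quotient {a} {m} {suc q} m<Q = begin
  (a * suc q + m) / suc q         ≡⟨ +-distrib-/-∣ˡ m (divides a refl) ⟩
  a * suc q / suc q + m / suc q   ≡⟨ cong₂ _+_ (m*n/n≡m a (suc q)) (m<n⇒m/n≡0 m<Q) ⟩
  a + 0                           ≡⟨ +-identityʳ a ⟩
  a                               ∎
  where open ≡-Reasoning

fsqrt-spec : ∀ n → fsqrt n * fsqrt n ≤ n × n < suc (fsqrt n) * suc (fsqrt n)
fsqrt-spec zero = z≤n , s≤s z≤n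
fsqrt-spec (suc n) with fsqrt n | fsqrt-spec n
... | r | r²≤n , n<[r+1]² with suc r * suc r ≤ᵇ suc n in eq
... | true  = ≤ᵇ⇒≤ (suc r * suc r) (suc n) (subst T (sym eq) tt)
            , ≤-<-trans n<[r+1]² (*-mono-< (n<1+n (suc r)) (n<1+n (suc r)))
... | false = m≤n⇒m≤1+n r²≤n , ≰⇒> (λ le → subst T eq (≤⇒≤ᵇ le))

≤-by-squares : ∀ {a b n} → a * a ≤ n → n < suc b * suc b → a ≤ b
≤-by-squares a²≤n n<[b+1]² = ≮⇒≥ λ b<a →
  <-irrefl refl (<-≤-trans n<[b+1]² (≤-trans (*-mono-≤ b<a b<a) a²≤n))

fsqrt-unique : ∀ {n r} → r * r ≤ n → n < suc r * suc r → fsqrt n ≡ r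
fsqrt-unique {n} r²≤n n<[r+1]² = ≤-antisym
  (≤-by-squares (proj₁ (fsqrt-spec n)) n<[r+1]²)
  (≤-by-squares r²≤n (proj₂ (fsqrt-spec n)))

fsqrt-near-square : ∀ {A N D} → 0 < N → N < 2 * A → D + N ≡ A * A → fsqrt D ≡ A ∸ 1
fsqrt-near-square {zero} _ () _
fsqrt-near-square {suc r} {N} {D} 0<N N<2A D+N≡A² = fsqrt-unique r²≤D D<A²
  where
  D<A² : D < suc r * suc r
  D<A² = subst (D <_) D+N≡A² (m<m+n D 0<N)
  expand : r * r + 2 * suc r ≡ suc (suc r * suc r)
  expand = solve (r ∷ [])
  r²≤D : r * r ≤ D
  r²≤D = +-cancelʳ-≤ N (r * r) D (subst (r * r + N ≤_) (sym D+N≡A²)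
           (≤-pred (subst (r * r + N <_) expand (+-monoʳ-< (r * r) N<2A))))

at-++ˡ : ∀ (xs : List ℕ) {ys i} → i < length xs → at (xs ++ ys) i ≡ at xs i
at-++ˡ (x ∷ xs) {i = zero}  _         = refl
at-++ˡ (x ∷ xs) {i = suc i} (s≤s i<n) = at-++ˡ xs i<n

at-∷ʳ : ∀ (xs : List ℕ) x → at (xs ∷ʳ x) (length xs) ≡ x
at-∷ʳ []       x = refl
at-∷ʳ (y ∷ xs) x = at-∷ʳ xs x

All-at : ∀ {P : ℕ → Set} {xs i} → All P xs → i < length xs → P (at xs i)
All-at {i = zero}  (px All.∷ _)   _         = px
All-at {i = suc i} (_  All.∷ pxs) (s≤s i<n) = All-at pxs i<n

All-reverse : ∀ {X : Set} {P : X → Set} {xs} → All P xs → All P (reverse xs)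
All-reverse All.[] = All.[]
All-reverse {xs = x ∷ xs} (px All.∷ pxs) =
  subst (All _) (sym (unfold-reverse x xs)) (∷ʳ⁺ (All-reverse pxs) px)

length-∷ʳ : ∀ {X : Set} (xs : List X) {x} → length (xs ∷ʳ x) ≡ suc (length xs)
length-∷ʳ xs = trans (length-++ xs) (+-comm (length xs) 1)

concatMap-upTo-suc : ∀ {X : Set} (f : ℕ → List X) n →
                     concatMap f (upTo (suc n)) ≡ concatMap f (upTo n) ++ f n
concatMap-upTo-suc f n = begin
  concatMap f (upTo (suc n))         ≡⟨ cong (concatMap f) (sym (upTo-∷ʳ n)) ⟩
  concatMap f (upTo n ∷ʳ n)          ≡⟨ concatMap-++ f (upTo n) (n ∷ []) ⟩
  concatMap f (upTo n) ++ f n ++ []  ≡⟨ cong (concatMap f (upTo n) ++_) (++-identityʳ (f n)) ⟩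
  concatMap f (upTo n) ++ f n        ∎
  where open ≡-Reasoning

reverse-concatMap-upTo-suc : ∀ {X : Set} (f : ℕ → List X) n →
  reverse (concatMap f (upTo (suc n))) ≡ reverse (f n) ++ reverse (concatMap f (upTo n))
reverse-concatMap-upTo-suc f n =
  trans (cong reverse (concatMap-upTo-suc f n)) (reverse-++ (concatMap f (upTo n)) (f n))

length-concatMap-upTo : ∀ {X : Set} {m} (f : ℕ → List X) → (∀ j → length (f j) ≡ m) →
                        ∀ n → length (concatMap f (upTo n)) ≡ n * m
length-concatMap-upTo f len zero    = refl
length-concatMap-upTo {m = m} f len (suc n) = begin
  length (concatMap f (upTo (suc n)))          ≡⟨ cong length (concatMap-upTo-suc f n) ⟩
  length (concatMap f (upTo n) ++ f n)         ≡⟨ length-++ (concatMap f (upTo n)) ⟩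
  length (concatMap f (upTo n)) + length (f n) ≡⟨ cong₂ _+_ (length-concatMap-upTo f len n) (len n) ⟩
  n * m + m                                    ≡⟨ +-comm (n * m) m ⟩
  suc n * m                                    ∎
  where open ≡-Reasoning

-- (P , Q) stands for the complete quotient (P + √D)/Q.
State : Set
State = ℕ × ℕ

module Expansion (D : ℕ) where

  quotient : State → ℕ
  quotient (P , Q) = div (fsqrt D + P) Q

  next : State → State
  next (P , Q) = let P′ = quotient (P , Q) * Q ∸ P in P′ , div (D ∸ P′ * P′) Q

  infix 4 _─⟨_⟩→_ _─[_]→_

  _─⟨_⟩→_ : State → ℕ → State → Set
  p ─⟨ a ⟩→ q = quotient p ≡ a × next p ≡ q

  data _─[_]→_ : State → List ℕ → State → Set where
    ε   : ∀ {p} → p ─[ [] ]→ p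
    _◅_ : ∀ {p q r a as} → p ─⟨ a ⟩→ q → q ─[ as ]→ r → p ─[ a ∷ as ]→ r

  infixr 5 _◅_ _◅◅_

  _◅◅_ : ∀ {p q r xs ys} → p ─[ xs ]→ q → q ─[ ys ]→ r → p ─[ xs ++ ys ]→ r
  ε          ◅◅ path′ = path′
  (s ◅ path) ◅◅ path′ = s ◅ (path ◅◅ path′)

  euclid-step : ∀ {r P Q a m P′ Q′} → fsqrt D ≡ r → r + P ≡ a * Q + m → m < Q →
                  P′ + P ≡ a * Q → Q′ * Q + P′ * P′ ≡ D → (P , Q) ─⟨ a ⟩→ (P′ , Q′)
  euclid-step {P = P} {Q} {a} {m} {P′} {Q′} refl r+P≡aQ+m m<Q P′+P≡aQ Q′Q+P′²≡D =
    quotient≡a , cong₂ _,_ P≡ Q≡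
    where
    open ≡-Reasoning
    quotient≡a : quotient (P , Q) ≡ a
    quotient≡a = trans (cong (λ t → div t Q) r+P≡aQ+m) (div-quotient m<Q)
    P≡ : quotient (P , Q) * Q ∸ P ≡ P′
    P≡ = begin
      quotient (P , Q) * Q ∸ P ≡⟨ cong (λ t → t * Q ∸ P) quotient≡a ⟩
      a * Q ∸ P             ≡⟨ cong (_∸ P) (sym P′+P≡aQ) ⟩
      P′ + P ∸ P            ≡⟨ m+n∸n≡m P′ P ⟩
      P′                    ∎
    Q≡ : div (D ∸ (quotient (P , Q) * Q ∸ P) * (quotient (P , Q) * Q ∸ P)) Q ≡ Q′
    Q≡ = begin
      div (D ∸ (quotient (P , Q) * Q ∸ P) * (quotient (P , Q) * Q ∸ P)) Q
        ≡⟨ cong (λ t → div (D ∸ t * t) Q) P≡ ⟩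
      div (D ∸ P′ * P′) Q
        ≡⟨ cong (λ t → div (t ∸ P′ * P′) Q) (sym Q′Q+P′²≡D) ⟩
      div (Q′ * Q + P′ * P′ ∸ P′ * P′) Q
        ≡⟨ cong (λ t → div t Q) (m+n∸n≡m (Q′ * Q) (P′ * P′)) ⟩
      div (Q′ * Q) Q
        ≡⟨ cong (λ t → div t Q) (sym (+-identityʳ (Q′ * Q))) ⟩
      div (Q′ * Q + 0) Q
        ≡⟨ div-quotient (≤-trans (s≤s z≤n) m<Q) ⟩
      Q′ ∎

  near-square-step : ∀ {A N c c′ Q Q′ a} → D + N ≡ A * A → fsqrt D ≡ A ∸ 1 →
    c ≤ A → 1 ≤ c′ → c′ ≤ A → c′ ≤ Q →
    a * Q + (c + c′) ≡ 2 * A → Q′ * Q + N + c′ * c′ ≡ 2 * A * c′ →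
    (A ∸ c , Q) ─⟨ a ⟩→ (A ∸ c′ , Q′)
  near-square-step {A} {N} {c} {suc m} {Q} {Q′} {a} D+N≡A² fsqrt-D c≤A _ c′≤A c′≤Q sum norm =
    euclid-step fsqrt-D division c′≤Q P′+P≡aQ (complete-square (m∸n+n≡m c′≤A) D+N≡A² norm)
    where
    1≤A : 1 ≤ A
    1≤A = ≤-trans (s≤s z≤n) c′≤A
    rearrange : a * Q + m + (1 + c) ≡ a * Q + (c + suc m)
    rearrange = solve (a ∷ Q ∷ m ∷ c ∷ [])
    division : A ∸ 1 + (A ∸ c) ≡ a * Q + m
    division = sum-of-complements (A ∸ 1) (A ∸ c) 1 c (m∸n+n≡m 1≤A) (m∸n+n≡m c≤A)
                 (trans rearrange sum)
    P′+P≡aQ : A ∸ suc m + (A ∸ c) ≡ a * Q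
    P′+P≡aQ = sum-of-complements (A ∸ suc m) (A ∸ c) (suc m) c (m∸n+n≡m c′≤A) (m∸n+n≡m c≤A)
                (trans (cong (a * Q +_) (+-comm (suc m) c)) sum)

  run-PQ : ∀ n {p q xs} → PQ D n ≡ p → p ─[ xs ]→ q → PQ D (n + length xs) ≡ q
  run-PQ n refl ε                  = cong (PQ D) (+-identityʳ n)
  run-PQ n refl ((_ , refl) ◅ path) = trans (cong (PQ D) (+-suc n _)) (run-PQ (suc n) refl path)

  run-cf : ∀ n {p q xs i} → PQ D n ≡ p → p ─[ xs ]→ q → i < length xs → cf D (n + i) ≡ at xs i
  run-cf n {i = zero}  refl ((a≡ , _) ◅ _)       _         = trans (cong (cf D) (+-identityʳ n)) a≡
  run-cf n {i = suc i} refl ((_ , refl) ◅ path) (s≤s i<n) =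
    trans (cong (cf D) (+-suc n i)) (run-cf (suc n) refl path i<n)

  cycle-PQ : ∀ n {p xs} → PQ D n ≡ p → p ─[ xs ]→ p → ∀ q → PQ D (n + q * length xs) ≡ p
  cycle-PQ n start path zero    = trans (cong (PQ D) (+-identityʳ n)) start
  cycle-PQ n {xs = xs} start path (suc q) =
    trans (cong (PQ D) reassoc) (run-PQ (n + q * length xs) (cycle-PQ n start path q) path)
    where
    reassoc : n + (length xs + q * length xs) ≡ n + q * length xs + length xs
    reassoc = trans (cong (n +_) (+-comm (length xs) _)) (sym (+-assoc n _ (length xs)))

  cycle-cf : ∀ {p xs L} .{{_ : NonZero L}} → length xs ≡ L → PQ D 1 ≡ p → p ─[ xs ]→ p →
             ∀ n → cf D (suc n) ≡ at xs (n % L)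
  cycle-cf {xs = xs} refl start path n = begin
    cf D (suc n)
      ≡⟨ cong (cf D ∘ suc) (trans (m≡m%n+[m/n]*n n L) (+-comm (n % L) _)) ⟩
    cf D (1 + n / L * L + n % L)
      ≡⟨ run-cf (1 + n / L * L) (cycle-PQ 1 start path (n / L)) path (m%n<n n L) ⟩
    at xs (n % L) ∎
    where
    open ≡-Reasoning
    L : ℕ
    L = length xs

  cycle-period : ∀ {p xs L} .{{_ : NonZero L}} → length xs ≡ L → PQ D 1 ≡ p → p ─[ xs ]→ p →
                 IsPeriod D L
  cycle-period {xs = xs} {L} len start path (suc n) _ = begin
    cf D (suc (n + L))     ≡⟨ cycle-cf len start path (n + L) ⟩
    at xs ((n + L) % L)    ≡⟨ cong (at xs) ([m+n]%n≡m%n n L) ⟩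
    at xs (n % L)          ≡⟨ sym (cycle-cf len start path n) ⟩
    cf D (suc n)           ∎
    where open ≡-Reasoning

  period-minimal : ∀ {L} → (∀ {n} → 0 < n → n < L → cf D n < cf D L) →
                   ∀ m → 0 < m → IsPeriod D m → L ≤ m
  period-minimal {L} below m 0<m period = ≮⇒≥ λ m<L →
    let n = L ∸ m
        0<n = m<n⇒0<n∸m m<L
    in <-irrefl (trans (sym (period n 0<n)) (cong (cf D) (m∸n+n≡m (<⇒≤ m<L))))
                (below 0<n (∸-monoʳ-< 0<m (<⇒≤ m<L)))

  cycle-PeriodLength : ∀ {p xs x L} → suc (length xs) ≡ L → PQ D 1 ≡ p → p ─[ xs ∷ʳ x ]→ p →
                       All (_< x) xs → PeriodLength D L
  cycle-PeriodLength {xs = xs} {x} refl start path xs<x =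
    s≤s z≤n , cycle-period (length-∷ʳ xs) start path , period-minimal below
    where
    at-cycle : ∀ {i} → i ≤ length xs → cf D (suc i) ≡ at (xs ∷ʳ x) i
    at-cycle i≤n = run-cf 1 start path (subst (_ <_) (sym (length-∷ʳ xs)) (s≤s i≤n))
    below : ∀ {n} → 0 < n → n < suc (length xs) → cf D n < cf D (suc (length xs))
    below {suc i} _ (s≤s i<n) = subst₂ _<_
      (sym (trans (at-cycle (<⇒≤ i<n)) (at-++ˡ xs i<n)))
      (sym (trans (at-cycle ≤-refl) (at-∷ʳ xs x)))
      (All-at xs<x i<n)

module NearSquare {b s N : ℕ} (1≤b : 1 ≤ b) (1≤s : 1 ≤ s) (1≤N : 1 ≤ N) where

  A : ℕ
  A = b * N + s

  D : ℕ
  D = A ^ 2 ∸ N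

  R : ℕ
  R = Rof b s

  open Expansion D public

  instance
    b≢0 : NonZero b
    b≢0 = >-nonZero 1≤b

  N<A : N < A
  N<A = ≤-<-trans (m≤n*m N b) (m<m+n (b * N) 1≤s)

  1≤A : 1 ≤ A
  1≤A = ≤-trans 1≤N (<⇒≤ N<A)

  D+N≡A² : D + N ≡ A * A
  D+N≡A² = begin
    A ^ 2 ∸ N + N  ≡⟨ m∸n+n≡m (subst (N ≤_) (sym A²≡A*A) N≤A*A) ⟩
    A ^ 2          ≡⟨ A²≡A*A ⟩
    A * A          ∎
    where
    open ≡-Reasoning
    A²≡A*A : A ^ 2 ≡ A * A
    A²≡A*A = cong (A *_) (*-identityʳ A)
    N≤A*A : N ≤ A * A
    N≤A*A = ≤-trans (<⇒≤ N<A) (m≤m*n A A {{>-nonZero (≤-<-trans z≤n N<A)}})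

  fsqrt-D : fsqrt D ≡ A ∸ 1
  fsqrt-D = fsqrt-near-square {A} 1≤N (<-≤-trans N<A (m≤m+n A _)) D+N≡A²

  factor-pos : ∀ {x y} → x * y ≡ N → 1 ≤ x
  factor-pos {zero}  refl = 1≤N
  factor-pos {suc x} _    = s≤s z≤n

  cofactor-pos : ∀ {x y} → x * y ≡ N → 1 ≤ y
  cofactor-pos {x} {y} xy≡N = factor-pos {y} {x} (trans (*-comm y x) xy≡N)

  factor≤A : ∀ {x y} → x * y ≡ N → x ≤ A
  factor≤A {x} {y} xy≡N = begin
    x      ≡⟨ sym (*-identityʳ x) ⟩
    x * 1  ≤⟨ *-monoʳ-≤ x (cofactor-pos {x} xy≡N) ⟩
    x * y  ≡⟨ xy≡N ⟩
    N      <⟨ N<A ⟩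
    A      ∎
    where open ≤-Reasoning

  factors+≤A : ∀ {z w} → z * w ≡ N → z + w ≤ A
  factors+≤A {z} {w} zw≡N = begin
    z + w      ≤⟨ m+n≤m*n+1 (factor-pos {z} zw≡N) (cofactor-pos {z} zw≡N) ⟩
    z * w + 1  ≡⟨ cong (_+ 1) zw≡N ⟩
    N + 1      ≤⟨ +-mono-≤ (m≤n*m N b) 1≤s ⟩
    A          ∎
    where open ≤-Reasoning

  U : ℕ → State
  U x = A ∸ x , x

  V : ℕ → State
  V z = A ∸ 2 * s , z

  W : ℕ → ℕ → State
  W z w = A ∸ z , 2 * A ∸ z ∸ w

  W-denominator : ∀ {z w} → z * w ≡ N → 2 * A ∸ z ∸ w + (z + w) ≡ 2 * A
  W-denominator {z} {w} zw≡N = begin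
    2 * A ∸ z ∸ w + (z + w)    ≡⟨ cong (_+ (z + w)) (∸-+-assoc (2 * A) z w) ⟩
    2 * A ∸ (z + w) + (z + w)  ≡⟨ m∸n+n≡m (≤-trans (factors+≤A {z} {w} zw≡N) (m≤m+n A _)) ⟩
    2 * A                      ∎
    where open ≡-Reasoning

  W-normˡ : ∀ {z w} → z * w ≡ N → (2 * A ∸ z ∸ w) * z + N + z * z ≡ 2 * A * z
  W-normˡ {z} {w} zw≡N = begin
    Q * z + N + z * z      ≡⟨ cong (λ n → Q * z + n + z * z) (sym zw≡N) ⟩
    Q * z + z * w + z * z  ≡⟨ expand Q z w ⟩
    (Q + (z + w)) * z      ≡⟨ cong (_* z) (W-denominator {z} {w} zw≡N) ⟩
    2 * A * z              ∎
    where
    open ≡-Reasoning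
    Q : ℕ
    Q = 2 * A ∸ z ∸ w
    expand : ∀ q z w → q * z + z * w + z * z ≡ (q + (z + w)) * z
    expand = solve-∀

  W-normʳ : ∀ {z w} → z * w ≡ N → w * (2 * A ∸ z ∸ w) + N + w * w ≡ 2 * A * w
  W-normʳ {z} {w} zw≡N = begin
    w * Q + N + w * w      ≡⟨ cong (λ n → w * Q + n + w * w) (sym zw≡N) ⟩
    w * Q + z * w + w * w  ≡⟨ expand Q z w ⟩
    (Q + (z + w)) * w      ≡⟨ cong (_* w) (W-denominator {z} {w} zw≡N) ⟩
    2 * A * w              ∎
    where
    open ≡-Reasoning
    Q : ℕ
    Q = 2 * A ∸ z ∸ w
    expand : ∀ q z w → w * q + z * w + w * w ≡ (q + (z + w)) * w
    expand = solve-∀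

  quotient-sum : ∀ {x y} → x * y ≡ N → (2 * b * y ∸ 1) * x + (x + 2 * s) ≡ 2 * A
  quotient-sum {x} {y} xy≡N = begin
    (2 * b * y ∸ 1) * x + (x + 2 * s)  ≡⟨ sym (+-assoc ((2 * b * y ∸ 1) * x) x (2 * s)) ⟩
    (2 * b * y ∸ 1) * x + x + 2 * s    ≡⟨ cong (_+ 2 * s) (pred[n]*m+m≡n*m x 1≤2by) ⟩
    2 * b * y * x + 2 * s              ≡⟨ solve (b ∷ s ∷ x ∷ y ∷ []) ⟩
    2 * (b * (x * y) + s)              ≡⟨ cong (λ n → 2 * (b * n + s)) xy≡N ⟩
    2 * A                              ∎
    where
    open ≡-Reasoning
    1≤2by : 1 ≤ 2 * b * y
    1≤2by = *-mono-≤ (≤-trans 1≤b (m≤m+n b _)) (cofactor-pos {x} xy≡N)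

  U⇒V : ∀ {x y} → x * y ≡ N → 2 * s ≤ x → U x ─⟨ 2 * b * y ∸ 1 ⟩→ V (R * y)
  U⇒V {x} {y} xy≡N 2s≤x = near-square-step D+N≡A² fsqrt-D
    x≤A (≤-trans 1≤s (m≤m+n s _)) (≤-trans 2s≤x x≤A) 2s≤x (quotient-sum {x} {y} xy≡N) norm
    where
    x≤A : x ≤ A
    x≤A = factor≤A {x} {y} xy≡N
    norm : R * y * x + N + 2 * s * (2 * s) ≡ 2 * A * (2 * s)
    norm = begin
      R * y * x + N + 2 * s * (2 * s)   ≡⟨ cong (λ n → n + N + 2 * s * (2 * s)) Ryx≡RN ⟩
      R * N + N + 2 * s * (2 * s)       ≡⟨ cong (_+ 2 * s * (2 * s)) (pred[n]*m+m≡n*m N 1≤4bs) ⟩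
      4 * b * s * N + 2 * s * (2 * s)   ≡⟨ solve (b ∷ s ∷ N ∷ []) ⟩
      2 * (b * N + s) * (2 * s)         ∎
      where
      open ≡-Reasoning
      Ryx≡RN : R * y * x ≡ R * N
      Ryx≡RN = trans (*-assoc R y x) (cong (R *_) (trans (*-comm y x) xy≡N))
      1≤4bs : 1 ≤ 4 * b * s
      1≤4bs = *-mono-≤ (≤-trans 1≤b (m≤m+n b _)) 1≤s

  V⇒W : ∀ {z w} → z * w ≡ N → 2 * s ≤ z → V z ─⟨ 2 * b * w ∸ 1 ⟩→ W z w
  V⇒W {z} {w} zw≡N 2s≤z = near-square-step D+N≡A² fsqrt-D
    (≤-trans 2s≤z z≤A) (factor-pos {z} zw≡N) z≤A ≤-refl sum (W-normˡ {z} {w} zw≡N)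
    where
    z≤A : z ≤ A
    z≤A = factor≤A {z} {w} zw≡N
    sum : (2 * b * w ∸ 1) * z + (2 * s + z) ≡ 2 * A
    sum = trans (cong ((2 * b * w ∸ 1) * z +_) (+-comm (2 * s) z)) (quotient-sum {z} {w} zw≡N)

  W⇒U : ∀ {z w} → z * w ≡ N → W z w ─⟨ 1 ⟩→ U w
  W⇒U {z} {w} zw≡N = near-square-step D+N≡A² fsqrt-D
    (factor≤A {z} {w} zw≡N) (cofactor-pos {z} zw≡N) w≤A w≤Q sum (W-normʳ {z} {w} zw≡N)
    where
    w≤A : w ≤ A
    w≤A = factor≤A {w} {z} (trans (*-comm w z) zw≡N)
    w≤Q : w ≤ 2 * A ∸ z ∸ w
    w≤Q = subst (w ≤_) (sym (∸-+-assoc (2 * A) z w))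
            (m+n≤o⇒m≤o∸n w (+-mono-≤ w≤A (≤-trans (factors+≤A {z} {w} zw≡N) (m≤m+n A 0))))
    sum : 1 * (2 * A ∸ z ∸ w) + (z + w) ≡ 2 * A
    sum = trans (cong (_+ (z + w)) (*-identityˡ (2 * A ∸ z ∸ w))) (W-denominator {z} {w} zw≡N)

  unit⇒W : ∀ {c a} → c ≤ A → a * 1 + (c + 1) ≡ 2 * A → (A ∸ c , 1) ─⟨ a ⟩→ W 1 N
  unit⇒W c≤A sum =
    near-square-step D+N≡A² fsqrt-D c≤A ≤-refl 1≤A ≤-refl sum (W-normˡ {1} {N} (*-identityˡ N))

  U1⇒W : U 1 ─⟨ 2 * (A ∸ 1) ⟩→ W 1 N
  U1⇒W = unit⇒W 1≤A (begin
    2 * (A ∸ 1) * 1 + (1 + 1)  ≡⟨ expand (A ∸ 1) ⟩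
    2 * (A ∸ 1 + 1)            ≡⟨ cong (2 *_) (m∸n+n≡m 1≤A) ⟩
    2 * A                      ∎)
    where
    open ≡-Reasoning
    expand : ∀ r → 2 * r * 1 + (1 + 1) ≡ 2 * (r + 1)
    expand = solve-∀

  start : (0 , 1) ─⟨ A ∸ 1 ⟩→ W 1 N
  start = subst (λ P → (P , 1) ─⟨ A ∸ 1 ⟩→ W 1 N) (n∸n≡0 A) (unit⇒W ≤-refl (begin
    (A ∸ 1) * 1 + (A + 1)  ≡⟨ expand (A ∸ 1) A ⟩
    (A ∸ 1 + 1) + A        ≡⟨ cong (_+ A) (m∸n+n≡m 1≤A) ⟩
    A + A                  ≡⟨ cong (A +_) (sym (+-identityʳ A)) ⟩
    2 * A                  ∎))
    where
    open ≡-Reasoning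
    expand : ∀ r a → r * 1 + (a + 1) ≡ r + 1 + a
    expand = solve-∀

module Family {b s : ℕ} (1≤b : 1 ≤ b) (1≤s : 1 ≤ s) (k : ℕ) where

  2s≤R : 2 * s ≤ Rof b s
  2s≤R = m+n≤o⇒m≤o∸n (2 * s) (begin
    2 * s + 1      ≤⟨ +-monoʳ-≤ (2 * s) (≤-trans 1≤s (m≤m+n s _)) ⟩
    2 * s + 2 * s  ≡⟨ solve (s ∷ []) ⟩
    4 * s          ≤⟨ *-monoˡ-≤ s (*-monoʳ-≤ 4 1≤b) ⟩
    4 * b * s      ∎)
    where open ≤-Reasoning

  instance
    R≢0 : NonZero (Rof b s)
    R≢0 = >-nonZero (≤-trans (≤-trans 1≤s (m≤m+n s _)) 2s≤R)

  N : ℕ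
  N = Rof b s ^ (2 * k + 1)

  open NearSquare 1≤b 1≤s (m^n>0 (Rof b s) (2 * k + 1)) public

  2s≤R^suc : ∀ e → 2 * s ≤ R ^ suc e
  2s≤R^suc e = begin
    2 * s      ≤⟨ 2s≤R ⟩
    R          ≡⟨ sym (*-identityʳ R) ⟩
    R * 1      ≤⟨ *-monoʳ-≤ R (m^n>0 R e) ⟩
    R * R ^ e  ∎
    where open ≤-Reasoning

  split : ∀ i j → i + j ≡ 2 * k → R ^ suc i * R ^ j ≡ N
  split i j i+j≡2k = begin
    R ^ suc i * R ^ j   ≡⟨ sym (^-distribˡ-+-* R (suc i) j) ⟩
    R ^ suc (i + j)     ≡⟨ cong (λ e → R ^ suc e) i+j≡2k ⟩
    R ^ suc (2 * k)     ≡⟨ cong (R ^_) (+-comm 1 (2 * k)) ⟩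
    N                   ∎
    where open ≡-Reasoning

  split′ : ∀ i j → i + j ≡ 2 * k → R ^ i * R ^ suc j ≡ N
  split′ i j i+j≡2k = trans (*-comm (R ^ i) (R ^ suc j)) (split j i (trans (+-comm j i) i+j≡2k))

  triple : ℕ → List ℕ
  triple j = 1 ∷ (2 * b * R ^ j ∸ 1) ∷ (2 * b * R ^ (2 * k ∸ j) ∸ 1) ∷ []

  W-triple : ∀ {t u} → t + u ≡ 2 * k → W (R ^ t) (R ^ suc u) ─[ triple t ]→ W (R ^ suc t) (R ^ u)
  W-triple {t} {u} t+u≡2k with refl ← trans (sym (m+n∸m≡n t u)) (cong (_∸ t) t+u≡2k) =
       W⇒U {R ^ t} {R ^ suc u} (split′ t u t+u≡2k)
     ◅ U⇒V {R ^ suc u} {R ^ t} (split u t (trans (+-comm u t) t+u≡2k)) (2s≤R^suc u)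
     ◅ V⇒W {R ^ suc t} {R ^ u} (split t u t+u≡2k) (2s≤R^suc t)
     ◅ ε

  U-triple : ∀ {j e} → j + e ≡ 2 * k → U (R ^ suc e) ─[ reverse (triple e) ]→ U (R ^ e)
  U-triple {j} {e} j+e≡2k with refl ← trans (sym (m+n∸n≡m j e)) (cong (_∸ e) j+e≡2k) =
       U⇒V {R ^ suc e} {R ^ j} (split e j (trans (+-comm e j) j+e≡2k)) (2s≤R^suc e)
     ◅ V⇒W {R ^ suc j} {R ^ e} (split j e j+e≡2k) (2s≤R^suc j)
     ◅ W⇒U {R ^ suc j} {R ^ e} (split j e j+e≡2k)
     ◅ ε

  W-phase : ∀ t {u} → t + u ≡ 2 * k → W 1 N ─[ concatMap triple (upTo t) ]→ W (R ^ t) (R ^ suc u)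
  W-phase zero refl = subst (λ e → W 1 N ─[ [] ]→ W 1 (R ^ e)) (+-comm (2 * k) 1) ε
  W-phase (suc t) {u} t+1+u≡2k =
    subst (λ xs → W 1 N ─[ xs ]→ W (R ^ suc t) (R ^ suc u)) (sym (concatMap-upTo-suc triple t))
      (W-phase t t+[u+1]≡2k ◅◅ W-triple {t} {suc u} t+[u+1]≡2k)
    where
    t+[u+1]≡2k : t + suc u ≡ 2 * k
    t+[u+1]≡2k = trans (+-suc t u) t+1+u≡2k

  U-phase : ∀ e → e ≤ suc (2 * k) → U (R ^ e) ─[ reverse (concatMap triple (upTo e)) ]→ U 1
  U-phase zero    _          = ε
  U-phase (suc e) (s≤s e≤2k) =
    subst (λ xs → U (R ^ suc e) ─[ xs ]→ U 1) (sym (reverse-concatMap-upTo-suc triple e))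
      (U-triple {2 * k ∸ e} {e} (m∸n+n≡m e≤2k) ◅◅ U-phase e (m≤n⇒m≤1+n e≤2k))

  c : ℕ
  c = 2 * b * R ^ k ∸ 1

  2k∸k≡k : 2 * k ∸ k ≡ k
  2k∸k≡k = trans (m+n∸m≡n k (k + 0)) (+-identityʳ k)

  k+k≡2k : k + k ≡ 2 * k
  k+k≡2k = cong (k +_) (sym (+-identityʳ k))

  cycle : W 1 N ─[ block b s k ]→ W 1 N
  cycle = subst (λ xs → W 1 N ─[ fseq b s k ++ 1 ∷ xs ++ 2 * (A ∸ 1) ∷ [] ]→ W 1 N) descent
    (  W-phase k k+k≡2k
    ◅◅ W⇒U {R ^ k} {R ^ suc k} (split′ k k k+k≡2k)
    ◅  U-phase (suc k) (s≤s (m≤m+n k (k + 0)))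
    ◅◅ U1⇒W
    ◅  ε)
    where
    descent : reverse (concatMap triple (upTo (suc k))) ≡ c ∷ c ∷ 1 ∷ reverse (fseq b s k)
    descent = trans (reverse-concatMap-upTo-suc triple k)
                    (cong (λ e → (2 * b * R ^ e ∸ 1) ∷ c ∷ 1 ∷ reverse (fseq b s k)) 2k∸k≡k)

  block-init : List ℕ
  block-init = fseq b s k ++ 1 ∷ c ∷ c ∷ 1 ∷ reverse (fseq b s k)

  block≡ : block b s k ≡ block-init ∷ʳ 2 * (A ∸ 1)
  block≡ = sym (++-assoc (fseq b s k) (1 ∷ c ∷ c ∷ 1 ∷ reverse (fseq b s k)) (2 * (A ∸ 1) ∷ []))

  length-init : suc (length block-init) ≡ 5 + 6 * k
  length-init = begin
    suc (length block-init)                                 ≡⟨ cong suc (length-++ (fseq b s k)) ⟩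
    suc (length (fseq b s k) + (4 + length (reverse (fseq b s k))))
      ≡⟨ cong (λ n → suc (length (fseq b s k) + (4 + n))) (length-reverse (fseq b s k)) ⟩
    suc (length (fseq b s k) + (4 + length (fseq b s k)))
      ≡⟨ cong (λ n → suc (n + (4 + n))) (length-concatMap-upTo triple (λ _ → refl) k) ⟩
    suc (k * 3 + (4 + k * 3))                               ≡⟨ solve (k ∷ []) ⟩
    5 + 6 * k                                               ∎
    where open ≡-Reasoning

  length-block : length (block b s k) ≡ 5 + 6 * k
  length-block = trans (cong length block≡) (trans (length-∷ʳ block-init) length-init)

  bN≤a₀ : b * N ≤ A ∸ 1
  bN≤a₀ = subst (b * N ≤_) (sym (+-∸-assoc (b * N) 1≤s)) (m≤m+n (b * N) (s ∸ 1))

  1<2a₀ : 1 < 2 * (A ∸ 1)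
  1<2a₀ = *-monoʳ-≤ 2 (≤-trans (*-mono-≤ 1≤b (m^n>0 R (2 * k + 1))) bN≤a₀)

  2bR^j∸1<2a₀ : ∀ {j} → j ≤ 2 * k + 1 → 2 * b * R ^ j ∸ 1 < 2 * (A ∸ 1)
  2bR^j∸1<2a₀ {j} j≤K = begin-strict
    2 * b * R ^ j ∸ 1  <⟨ ∸-monoʳ-< (s≤s z≤n) (*-mono-≤ (≤-trans 1≤b (m≤m+n b _)) (m^n>0 R j)) ⟩
    2 * b * R ^ j      ≤⟨ *-monoʳ-≤ (2 * b) (^-monoʳ-≤ R j≤K) ⟩
    2 * b * N          ≡⟨ *-assoc 2 b N ⟩
    2 * (b * N)        ≤⟨ *-monoʳ-≤ 2 bN≤a₀ ⟩
    2 * (A ∸ 1)        ∎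
    where open ≤-Reasoning

  init-bounded : All (_< 2 * (A ∸ 1)) block-init
  init-bounded = ++⁺ fseq-bounded
    (1<2a₀ ∷ c<2a₀ ∷ c<2a₀ ∷ 1<2a₀ ∷ All-reverse fseq-bounded)
    where
    open import Data.List.Relation.Unary.All using (_∷_; [])
    ≤2k+1 : ∀ {j} → j ≤ 2 * k → j ≤ 2 * k + 1
    ≤2k+1 j≤2k = ≤-trans j≤2k (m≤m+n (2 * k) 1)
    c<2a₀ : c < 2 * (A ∸ 1)
    c<2a₀ = 2bR^j∸1<2a₀ (≤2k+1 (m≤m+n k (k + 0)))
    triple-bounded : ∀ {j} → j < k → All (_< 2 * (A ∸ 1)) (triple j)
    triple-bounded {j} j<k = 1<2a₀
      ∷ 2bR^j∸1<2a₀ (≤2k+1 (≤-trans (<⇒≤ j<k) (m≤m+n k (k + 0))))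
      ∷ 2bR^j∸1<2a₀ (≤2k+1 (m∸n≤m (2 * k) j))
      ∷ []
    fseq-bounded : All (_< 2 * (A ∸ 1)) (fseq b s k)
    fseq-bounded = concat⁺ (map⁺ (applyUpTo⁺₁ id k triple-bounded))

corollary7 : (b s k : ℕ) → 1 ≤ b → 1 ≤ s → 1 ≤ k →
    PeriodLength (Dof b s k) (5 + 6 * k)
    × cf (Dof b s k) 0 ≡ a0of b s k
    × (∀ n → cf (Dof b s k) (suc n) ≡ at (block b s k) (n % (5 + 6 * k)))
corollary7 b s k 1≤b 1≤s _ =
    cycle-PeriodLength length-init (proj₂ start)
      (subst (λ xs → W 1 N ─[ xs ]→ W 1 N) block≡ cycle) init-bounded
  , proj₁ start
  , cycle-cf length-block (proj₂ start) cycle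
  where open Family 1≤b 1≤s k
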